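{- Let $m$ and $d$ be positive integers with $d < 2m$. Then $\mathsf{s}_{2m}(\mathbb{Z}_2^d) = 2m + d$.
   Context: For a positive integer $m$ and a nonnegative integer $d$, $\mathsf{s}_{2m}(\mathbb{Z}_2^d)$ denotes the smallest integer $s$ such that every sequence (repetitions allowed) of length $s$ of elements of the group $\mathbb{Z}_2^d$ has a subsequence of length $2m$ whose elements sum to $0$. -}

module Defs where

open import Data.Nat using (ℕ; _≤_)
open import Data.Bool using (Bool; false; _xor_)
open import Data.Vec using (Vec; replicate; zipWith; lookup)
open import Data.Fin using (Fin)
open import Data.Fin.Subset using (Subset; inside; ∣_∣)
open import Data.Product using (_×_; ∃)
open import Relation.Binary.PropositionalEquality using (_≡_)

Z2^ : ℕ → Set
Z2^ d = Vec Bool d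

0G : ∀ {d} → Z2^ d
0G {d} = replicate d false

_⊕_ : ∀ {d} → Z2^ d → Z2^ d → Z2^ d
_⊕_ = zipWith _xor_

-- Sum of the terms of a sequence x : Fin s → Z_2^d indexed by a subset I of
-- positions (a subsequence, i.e. a set of indices, repetitions of values allowed).
subSum : ∀ {d s} → (Fin s → Z2^ d) → Subset s → Z2^ d
subSum {d} {ℕ.zero}  x I = 0G
subSum {d} {ℕ.suc s} x (b Data.Vec.∷ I) =
  (if b then x Fin.zero else 0G) ⊕ subSum (λ i → x (Fin.suc i)) I
  where open import Data.Bool using (if_then_else_)

HasZeroSumSubseq : ℕ → ℕ → ℕ → Set
HasZeroSumSubseq k d s =
  (x : Fin s → Z2^ d) → ∃ λ (I : Subset s) → ∣ I ∣ ≡ k × subSum x I ≡ 0G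

IsS : ℕ → ℕ → ℕ → Set
IsS k d n = HasZeroSumSubseq k d n × (∀ s → HasZeroSumSubseq k d s → n ≤ s)

-- Subsets of positions are bit vectors, i.e. elements of Z_2^s, so they add by ⊕
-- (symmetric difference) and subSum x is a homomorphism in the subset. Every inductive
-- step lowers the dimension through a projection Z_2^(n+1) → Z_2^n with kernel {0, w}.
--
-- The key lemma fixed-size: among at least 2n + 1 terms of Z_2^n, a sum over
-- a subsequence whose size has the parity of n is also a sum of exactly n terms. If the
-- terms are all equal this is clear; otherwise Davenport's bound (n + 1 terms of Z_2^n
-- have a nonempty zero-sum subsequence), applied to the lifted terms (1, x i), gives an
-- even zero-sum subsequence, which lets us assume the subsequence contains exactly one of
-- two terms e, e′ with x e ≠ x e′; projecting away x e ⊕ x e′ and deleting e, e′ reduces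
-- to dimension n - 1. For the whole sequence of length 2m + d, the total sum is then a sum
-- of d terms, and the complementary 2m terms sum to 0.
--
-- Lower bound. e₁, …, e_d followed by 2m - 1 zeros has no zero-sum subsequence of length 2m.

module Submission where

open import Defs
open import Data.Nat using (ℕ; zero; suc; _+_; _*_; _∸_; _<_; _≤_; z≤n; s≤s; s≤s⁻¹; _≤?_)
open import Data.Nat.Properties
  using (+-suc; +-comm; ≤-trans; m≤m+n; ≤-refl; n≤1+n; m≤n+m; ≤∧≢⇒<; 1+n≰n; ≰⇒>; +-monoˡ-≤; +-identityʳ; m+n∸n≡m; m≤n⇒∃[o]m+o≡n)
open import Data.Bool using (Bool; true; false; not; _xor_; if_then_else_)
open import Data.Bool.Properties using (xor-assoc; xor-comm; not-distribˡ-xor; not-distribʳ-xor; xor-same; xor-identityʳ; not-involutive)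
  renaming (_≟_ to _≟ᵇ_)
open import Data.Vec using ([]; _∷_; lookup; _++_; here; there)
open import Data.Vec.Properties using (∷-injectiveˡ; ∷-injectiveʳ; ≡-dec; lookup-zipWith; []=⇒lookup; lookup⇒[]=)
open import Data.Fin using (Fin; _↑ˡ_) renaming (zero to fzero; suc to fsuc)
open import Data.Fin.Properties using (any?)
open import Data.Fin.Subset using (Subset; ∣_∣; _∈_; _∉_; _⊆_; ⁅_⁆; ⊥; ⊤; ∁; _-_; Nonempty)
open import Data.Fin.Subset.Properties
  using (_∈?_; nonempty?; Empty-unique; ∣⊥∣≡0; ⊥⊆; ⊆-refl; ⊆-trans; ∣⊤∣≡n; ∣∁p∣≡n∸∣p∣;
         p⊆q⇒∣p∣≤∣q∣; ∣p∣≤n; p─q⊆p; x∈⁅x⁆; p─⊥≡p; x∈⁅y⁆⇒x≡y; x≢y⇒x∉⁅y⁆; ∣⁅x⁆∣≡1; x∈p∧x≢y⇒x∈p-y; s⊆s)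
open import Data.Product using (∃; Σ-syntax; _×_; _,_)
open import Data.Sum using (_⊎_; inj₁; inj₂)
open import Data.Empty using (⊥-elim)
open import Function using (_∘_)
open import Relation.Nullary using (¬_; Dec; yes; no)
open import Relation.Nullary.Decidable using (_×-dec_; ¬?; decidable-stable)
open import Relation.Binary.PropositionalEquality
  using (_≡_; _≢_; refl; sym; trans; cong; cong₂; subst; ≢-sym; module ≡-Reasoning)

open ≡-Reasoning

⊕-assoc : ∀ {n} (a b c : Z2^ n) → (a ⊕ b) ⊕ c ≡ a ⊕ (b ⊕ c)
⊕-assoc []       []       []       = refl
⊕-assoc (a ∷ as) (b ∷ bs) (c ∷ cs) = cong₂ _∷_ (xor-assoc a b c) (⊕-assoc as bs cs)

⊕-comm : ∀ {n} (a b : Z2^ n) → a ⊕ b ≡ b ⊕ a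
⊕-comm []       []       = refl
⊕-comm (a ∷ as) (b ∷ bs) = cong₂ _∷_ (xor-comm a b) (⊕-comm as bs)

⊕-identityˡ : ∀ {n} (a : Z2^ n) → 0G ⊕ a ≡ a
⊕-identityˡ []       = refl
⊕-identityˡ (a ∷ as) = cong (a ∷_) (⊕-identityˡ as)

⊕-identityʳ : ∀ {n} (a : Z2^ n) → a ⊕ 0G ≡ a
⊕-identityʳ a = trans (⊕-comm a 0G) (⊕-identityˡ a)

⊕-self : ∀ {n} (a : Z2^ n) → a ⊕ a ≡ 0G
⊕-self []       = refl
⊕-self (a ∷ as) = cong₂ _∷_ (xor-same a) (⊕-self as)

⊕-cancelˡ : ∀ {n} (a b : Z2^ n) → a ⊕ (a ⊕ b) ≡ b
⊕-cancelˡ a b = begin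
  a ⊕ (a ⊕ b)  ≡⟨ ⊕-assoc a a b ⟨
  (a ⊕ a) ⊕ b  ≡⟨ cong (_⊕ b) (⊕-self a) ⟩
  0G ⊕ b       ≡⟨ ⊕-identityˡ b ⟩
  b            ∎

⊕-cancelʳ : ∀ {n} (a b : Z2^ n) → (a ⊕ b) ⊕ b ≡ a
⊕-cancelʳ a b = begin
  (a ⊕ b) ⊕ b  ≡⟨ ⊕-assoc a b b ⟩
  a ⊕ (b ⊕ b)  ≡⟨ cong (a ⊕_) (⊕-self b) ⟩
  a ⊕ 0G       ≡⟨ ⊕-identityʳ a ⟩
  a            ∎

⊕-interchange : ∀ {n} (a b c d : Z2^ n) → (a ⊕ b) ⊕ (c ⊕ d) ≡ (a ⊕ c) ⊕ (b ⊕ d)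
⊕-interchange a b c d = begin
  (a ⊕ b) ⊕ (c ⊕ d)  ≡⟨ ⊕-assoc a b (c ⊕ d) ⟩
  a ⊕ (b ⊕ (c ⊕ d))  ≡⟨ cong (a ⊕_) (⊕-assoc b c d) ⟨
  a ⊕ ((b ⊕ c) ⊕ d)  ≡⟨ cong (λ u → a ⊕ (u ⊕ d)) (⊕-comm b c) ⟩
  a ⊕ ((c ⊕ b) ⊕ d)  ≡⟨ cong (a ⊕_) (⊕-assoc c b d) ⟩
  a ⊕ (c ⊕ (b ⊕ d))  ≡⟨ ⊕-assoc a c (b ⊕ d) ⟨
  (a ⊕ c) ⊕ (b ⊕ d)  ∎

⊕-exchange : ∀ {n} (a b c : Z2^ n) → (a ⊕ b) ⊕ (c ⊕ a) ≡ c ⊕ b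
⊕-exchange a b c = begin
  (a ⊕ b) ⊕ (c ⊕ a)  ≡⟨ ⊕-comm (a ⊕ b) (c ⊕ a) ⟩
  (c ⊕ a) ⊕ (a ⊕ b)  ≡⟨ ⊕-assoc c a (a ⊕ b) ⟩
  c ⊕ (a ⊕ (a ⊕ b))  ≡⟨ cong (c ⊕_) (⊕-cancelˡ a b) ⟩
  c ⊕ b              ∎

⊕-solve : ∀ {n} {a b c : Z2^ n} → a ⊕ b ≡ c → a ≡ c ⊕ b
⊕-solve {a = a} {b} refl = sym (⊕-cancelʳ a b)

⊕-unique : ∀ {n} {a b : Z2^ n} → a ⊕ b ≡ 0G → a ≡ b
⊕-unique {b = b} e = trans (⊕-solve e) (⊕-identityˡ b)

infix 25 _·_
_·_ : ∀ {n} → Bool → Z2^ n → Z2^ n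
b · v = if b then v else 0G

·-xor : ∀ {n} (a b : Bool) (v : Z2^ n) → (a xor b) · v ≡ a · v ⊕ b · v
·-xor false b     v = sym (⊕-identityˡ (b · v))
·-xor true  false v = sym (⊕-identityʳ v)
·-xor true  true  v = sym (⊕-self v)

·-not : ∀ {n} (b : Bool) (v : Z2^ n) → v ⊕ b · v ≡ not b · v
·-not true  v = ⊕-self v
·-not false v = ⊕-identityʳ v

_≟_ : ∀ {n} (a b : Z2^ n) → Dec (a ≡ b)
_≟_ = ≡-dec _≟ᵇ_

Z2^0-trivial : (a b : Z2^ 0) → a ≡ b
Z2^0-trivial [] [] = refl

Linear : ∀ {m n} → (Z2^ m → Z2^ n) → Set
Linear f = ∀ a b → f (a ⊕ b) ≡ f a ⊕ f b

linear-0 : ∀ {m n} {f : Z2^ m → Z2^ n} → Linear f → f 0G ≡ 0G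
linear-0 {f = f} lin = begin
  f 0G                ≡⟨ cong f (⊕-self 0G) ⟨
  f (0G ⊕ 0G)         ≡⟨ lin 0G 0G ⟩
  f 0G ⊕ f 0G         ≡⟨ ⊕-self (f 0G) ⟩
  0G                  ∎

parity : ℕ → Bool
parity zero    = false
parity (suc n) = not (parity n)

parity-+ : ∀ m n → parity (m + n) ≡ parity m xor parity n
parity-+ zero    n = refl
parity-+ (suc m) n = trans (cong not (parity-+ m n)) (not-distribˡ-xor (parity m) (parity n))

parity-double : ∀ n → parity (n + n) ≡ false
parity-double n = trans (parity-+ n n) (xor-same (parity n))

parity-∣⊕∣ : ∀ {s} (p q : Subset s) → parity ∣ p ⊕ q ∣ ≡ parity ∣ p ∣ xor parity ∣ q ∣
parity-∣⊕∣ []          []          = refl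
parity-∣⊕∣ (false ∷ p) (false ∷ q) = parity-∣⊕∣ p q
parity-∣⊕∣ (false ∷ p) (true  ∷ q) = trans (cong not (parity-∣⊕∣ p q)) (not-distribʳ-xor (parity ∣ p ∣) (parity ∣ q ∣))
parity-∣⊕∣ (true  ∷ p) (false ∷ q) = trans (cong not (parity-∣⊕∣ p q)) (not-distribˡ-xor (parity ∣ p ∣) (parity ∣ q ∣))
parity-∣⊕∣ (true  ∷ p) (true  ∷ q) = begin
  parity ∣ p ⊕ q ∣                  ≡⟨ parity-∣⊕∣ p q ⟩
  parity ∣ p ∣ xor parity ∣ q ∣      ≡⟨ not-involutive _ ⟨
  not (not (parity ∣ p ∣ xor parity ∣ q ∣)) ≡⟨ cong not (not-distribˡ-xor (parity ∣ p ∣) _) ⟩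
  not (not (parity ∣ p ∣) xor parity ∣ q ∣) ≡⟨ not-distribʳ-xor (not (parity ∣ p ∣)) _ ⟩
  not (parity ∣ p ∣) xor not (parity ∣ q ∣) ∎

module _ {n : ℕ} where

  subSum-⊕ : ∀ {s} (x : Fin s → Z2^ n) (I J : Subset s) →
             subSum x (I ⊕ J) ≡ subSum x I ⊕ subSum x J
  subSum-⊕ {zero}  x []      []      = sym (⊕-self 0G)
  subSum-⊕ {suc s} x (a ∷ I) (b ∷ J) = begin
    (a xor b) · x₀ ⊕ subSum x′ (I ⊕ J)              ≡⟨ cong₂ _⊕_ (·-xor a b x₀) (subSum-⊕ x′ I J) ⟩
    (a · x₀ ⊕ b · x₀) ⊕ (subSum x′ I ⊕ subSum x′ J) ≡⟨ ⊕-interchange (a · x₀) _ _ _ ⟩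
    (a · x₀ ⊕ subSum x′ I) ⊕ (b · x₀ ⊕ subSum x′ J) ∎
    where
    x₀ = x fzero
    x′ = x ∘ fsuc

  subSum-⊥ : ∀ {s} (x : Fin s → Z2^ n) → subSum x ⊥ ≡ 0G
  subSum-⊥ {zero}  x = refl
  subSum-⊥ {suc s} x = trans (⊕-identityˡ _) (subSum-⊥ (x ∘ fsuc))

  subSum-⁅⁆ : ∀ {s} (x : Fin s → Z2^ n) (i : Fin s) → subSum x ⁅ i ⁆ ≡ x i
  subSum-⁅⁆ x fzero    = trans (cong (x fzero ⊕_) (subSum-⊥ (x ∘ fsuc))) (⊕-identityʳ (x fzero))
  subSum-⁅⁆ x (fsuc i) = trans (⊕-identityˡ _) (subSum-⁅⁆ (x ∘ fsuc) i)

  subSum-constant : ∀ {s} (x : Fin s → Z2^ n) (I : Subset s) {c : Z2^ n} →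
                    (∀ {i} → i ∈ I → x i ≡ c) → subSum x I ≡ parity ∣ I ∣ · c
  subSum-constant {zero}  x []        const = refl
  subSum-constant {suc s} x (false ∷ I) const =
    trans (⊕-identityˡ _) (subSum-constant (x ∘ fsuc) I (const ∘ there))
  subSum-constant {suc s} x (true ∷ I) {c} const = begin
    x fzero ⊕ subSum (x ∘ fsuc) I  ≡⟨ cong₂ _⊕_ (const here) (subSum-constant (x ∘ fsuc) I (const ∘ there)) ⟩
    c ⊕ parity ∣ I ∣ · c            ≡⟨ ·-not (parity ∣ I ∣) c ⟩
    not (parity ∣ I ∣) · c          ∎

subSum-linear : ∀ {m n s} {f : Z2^ m → Z2^ n} → Linear f →
                (x : Fin s → Z2^ m) (I : Subset s) → subSum (f ∘ x) I ≡ f (subSum x I)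
subSum-linear {s = zero}  lin x []      = sym (linear-0 lin)
subSum-linear {s = suc s} {f} lin x (b ∷ I) = begin
  b · f (x fzero) ⊕ subSum (f ∘ x ∘ fsuc) I   ≡⟨ cong₂ _⊕_ (scalar b) (subSum-linear lin (x ∘ fsuc) I) ⟩
  f (b · x fzero) ⊕ f (subSum (x ∘ fsuc) I)  ≡⟨ lin _ _ ⟨
  f (b · x fzero ⊕ subSum (x ∘ fsuc) I)      ∎
  where
  scalar : ∀ b → b · f (x fzero) ≡ f (b · x fzero)
  scalar true  = refl
  scalar false = sym (linear-0 lin)

module _ {s : ℕ} {i : Fin s} {p q : Subset s} where

  private
    lookup-⊕ : lookup (p ⊕ q) i ≡ lookup p i xor lookup q i
    lookup-⊕ = lookup-zipWith _xor_ i p q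

    ∉⇒false : ∀ {r : Subset s} → i ∉ r → lookup r i ≡ false
    ∉⇒false {r} i∉r with lookup r i in eq
    ... | true  = ⊥-elim (i∉r (lookup⇒[]= i r eq))
    ... | false = refl

    false⇒∉ : ∀ {r : Subset s} → lookup r i ≡ false → i ∉ r
    false⇒∉ eq i∈r with trans (sym eq) ([]=⇒lookup i∈r)
    ... | ()

  ∈-⊕ˡ : i ∈ p → i ∉ q → i ∈ p ⊕ q
  ∈-⊕ˡ i∈p i∉q = lookup⇒[]= i (p ⊕ q) (trans lookup-⊕ (cong₂ _xor_ ([]=⇒lookup i∈p) (∉⇒false i∉q)))

  ∈-⊕ʳ : i ∉ p → i ∈ q → i ∈ p ⊕ q
  ∈-⊕ʳ i∉p i∈q = lookup⇒[]= i (p ⊕ q) (trans lookup-⊕ (cong₂ _xor_ (∉⇒false i∉p) ([]=⇒lookup i∈q)))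

  ∉-⊕ : i ∉ p → i ∉ q → i ∉ p ⊕ q
  ∉-⊕ i∉p i∉q = false⇒∉ (trans lookup-⊕ (cong₂ _xor_ (∉⇒false i∉p) (∉⇒false i∉q)))

  ∉-⊕-both : i ∈ p → i ∈ q → i ∉ p ⊕ q
  ∉-⊕-both i∈p i∈q = false⇒∉ (trans lookup-⊕ (cong₂ _xor_ ([]=⇒lookup i∈p) ([]=⇒lookup i∈q)))

module _ {s : ℕ} where

  ⊕-⊆ : ∀ {p q A : Subset s} → p ⊆ A → q ⊆ A → p ⊕ q ⊆ A
  ⊕-⊆ {p} {q} p⊆A q⊆A {i} i∈p⊕q with i ∈? p | i ∈? q
  ... | yes i∈p | _       = p⊆A i∈p
  ... | no  _   | yes i∈q = q⊆A i∈q
  ... | no  i∉p | no  i∉q = ⊥-elim (∉-⊕ i∉p i∉q i∈p⊕q)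

  ⁅⁆⊆ : ∀ {i} {A : Subset s} → i ∈ A → ⁅ i ⁆ ⊆ A
  ⁅⁆⊆ {i} i∈A j∈⁅i⁆ = subst (_∈ _) (sym (x∈⁅y⁆⇒x≡y i j∈⁅i⁆)) i∈A

  ⊆-minus : ∀ {T A : Subset s} {e} → T ⊆ A → e ∉ T → T ⊆ A - e
  ⊆-minus T⊆A e∉T i∈T = x∈p∧x≢y⇒x∈p-y (T⊆A i∈T) λ { refl → e∉T i∈T }

∉-removed : ∀ {s} (p : Subset s) (i : Fin s) → i ∉ p - i
∉-removed (b ∷ p) fzero    ()
∉-removed (b ∷ p) (fsuc i) (there i∈) = ∉-removed p i i∈

∣⊕⁅⁆∣ : ∀ {s} (p : Subset s) (i : Fin s) → i ∉ p → ∣ p ⊕ ⁅ i ⁆ ∣ ≡ suc ∣ p ∣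
∣⊕⁅⁆∣ (true  ∷ p) fzero    i∉p = ⊥-elim (i∉p here)
∣⊕⁅⁆∣ (false ∷ p) fzero    _   = cong (suc ∘ ∣_∣) (⊕-identityʳ p)
∣⊕⁅⁆∣ (true  ∷ p) (fsuc i) i∉p = cong suc (∣⊕⁅⁆∣ p i (i∉p ∘ there))
∣⊕⁅⁆∣ (false ∷ p) (fsuc i) i∉p = ∣⊕⁅⁆∣ p i (i∉p ∘ there)

∣-∣ : ∀ {s} (p : Subset s) (i : Fin s) → i ∈ p → suc ∣ p - i ∣ ≡ ∣ p ∣
∣-∣ (true  ∷ p) fzero    _          = cong (suc ∘ ∣_∣) (p─⊥≡p p)
∣-∣ (true  ∷ p) (fsuc i) (there i∈) = cong suc (∣-∣ p i i∈)
∣-∣ (false ∷ p) (fsuc i) (there i∈) = ∣-∣ p i i∈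

element : ∀ {s} (p : Subset s) → 1 ≤ ∣ p ∣ → Nonempty p
element {s} p 1≤∣p∣ with nonempty? p
... | yes ne    = ne
... | no  empty = ⊥-elim (1+n≰n (subst (1 ≤_) (trans (cong ∣_∣ (Empty-unique empty)) (∣⊥∣≡0 s)) 1≤∣p∣))

outside : ∀ {s} (p q : Subset s) → ∣ q ∣ < ∣ p ∣ → ∃ λ i → i ∈ p × i ∉ q
outside p q ∣q∣<∣p∣ with any? (λ i → (i ∈? p) ×-dec ¬? (i ∈? q))
... | yes found = found
... | no  none  = ⊥-elim (1+n≰n (≤-trans ∣q∣<∣p∣ (p⊆q⇒∣p∣≤∣q∣ p⊆q)))
  where
  p⊆q : p ⊆ q
  p⊆q {i} i∈p = decidable-stable (i ∈? q) (λ i∉q → none (i , i∈p , i∉q))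

choose : ∀ {s} (p : Subset s) k → k ≤ ∣ p ∣ → ∃ λ q → q ⊆ p × ∣ q ∣ ≡ k
choose {s} p      zero    _         = ⊥ , ⊥⊆ , ∣⊥∣≡0 s
choose (true  ∷ p) (suc k) (s≤s k≤) with choose p k k≤
... | q , q⊆p , ∣q∣ = true ∷ q , s⊆s q⊆p , cong suc ∣q∣
choose (false ∷ p) (suc k) k≤ with choose p (suc k) k≤
... | q , q⊆p , ∣q∣ = false ∷ q , s⊆s q⊆p , ∣q∣

∁≡⊕⊤ : ∀ {s} (p : Subset s) → ∁ p ≡ p ⊕ ⊤
∁≡⊕⊤ []          = refl
∁≡⊕⊤ (true  ∷ p) = cong (false ∷_) (∁≡⊕⊤ p)
∁≡⊕⊤ (false ∷ p) = cong (true ∷_) (∁≡⊕⊤ p)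

-- Collapsing a nonzero vector w: a homomorphism Z_2^(n+1) → Z_2^n whose kernel is
-- exactly {0, w}. It lets every argument below proceed by induction on the dimension.

record Collapse {n} (w : Z2^ (suc n)) : Set where
  field
    φ      : Z2^ (suc n) → Z2^ n
    linear : Linear φ
    kernel : ∀ a → φ a ≡ 0G → a ≡ 0G ⊎ a ≡ w

  fibre : ∀ a b → φ a ≡ φ b → a ≡ b ⊎ a ≡ w ⊕ b
  fibre a b φa≡φb with kernel (a ⊕ b) (trans (linear a b) (trans (cong (_⊕ φ b) φa≡φb) (⊕-self (φ b))))
  ... | inj₁ a⊕b≡0 = inj₁ (⊕-unique a⊕b≡0)
  ... | inj₂ a⊕b≡w = inj₂ (⊕-solve a⊕b≡w)

collapse : ∀ {n} (w : Z2^ (suc n)) → w ≢ 0G → Collapse w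
collapse {n} (true ∷ w) _ = record { φ = φ ; linear = linear ; kernel = kernel }
  where
  -- Eliminate the first coordinate using w.
  φ : Z2^ (suc n) → Z2^ n
  φ (a ∷ as) = as ⊕ a · w

  linear : Linear φ
  linear (a ∷ as) (b ∷ bs) = begin
    (as ⊕ bs) ⊕ (a xor b) · w        ≡⟨ cong ((as ⊕ bs) ⊕_) (·-xor a b w) ⟩
    (as ⊕ bs) ⊕ (a · w ⊕ b · w)      ≡⟨ ⊕-interchange as bs _ _ ⟩
    (as ⊕ a · w) ⊕ (bs ⊕ b · w)      ∎

  kernel : ∀ a → φ a ≡ 0G → a ≡ 0G ⊎ a ≡ true ∷ w
  kernel (false ∷ as) φa≡0 = inj₁ (cong (false ∷_) (trans (sym (⊕-identityʳ as)) φa≡0))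
  kernel (true  ∷ as) φa≡0 = inj₂ (cong (true ∷_) (⊕-unique φa≡0))
collapse {zero}  (false ∷ []) w≢0 = ⊥-elim (w≢0 refl)
collapse {suc n} (false ∷ w)  w≢0 = record { φ = φ ; linear = linear ; kernel = kernel }
  where
  -- The first coordinate of w vanishes: keep it and collapse w in the rest.
  open Collapse (collapse w (w≢0 ∘ cong (false ∷_))) renaming (φ to φ′; linear to linear′; kernel to kernel′)

  φ : Z2^ (suc (suc n)) → Z2^ (suc n)
  φ (a ∷ as) = a ∷ φ′ as

  linear : Linear φ
  linear (a ∷ as) (b ∷ bs) = cong ((a xor b) ∷_) (linear′ as bs)

  kernel : ∀ a → φ a ≡ 0G → a ≡ 0G ⊎ a ≡ false ∷ w
  kernel (a ∷ as) φa≡0 with ∷-injectiveˡ φa≡0 | kernel′ as (∷-injectiveʳ φa≡0)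
  ... | refl | inj₁ as≡0 = inj₁ (cong (false ∷_) as≡0)
  ... | refl | inj₂ as≡w = inj₂ (cong (false ∷_) as≡w)

record ZeroSum {n s} (x : Fin s → Z2^ n) (A : Subset s) (k : ℕ) : Set where
  constructor zeroSum
  field
    Z        : Subset s
    Z⊆A      : Z ⊆ A
    nonempty : 1 ≤ ∣ Z ∣
    short    : ∣ Z ∣ ≤ k
    zero-sum : subSum x Z ≡ 0G

module _ {n s} {x : Fin s → Z2^ n} {A : Subset s} where

  singleton : ∀ {i k} → i ∈ A → x i ≡ 0G → 1 ≤ k → ZeroSum x A k
  singleton {i} i∈A xi≡0 1≤k = zeroSum ⁅ i ⁆ (⁅⁆⊆ i∈A) (subst (1 ≤_) (sym ∣i∣) ≤-refl)
                                 (subst (_≤ _) (sym ∣i∣) 1≤k) (trans (subSum-⁅⁆ x i) xi≡0)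
    where ∣i∣ = ∣⁅x⁆∣≡1 i

davenport : ∀ n {s} (x : Fin s → Z2^ n) (A : Subset s) → suc n ≤ ∣ A ∣ → ZeroSum x A (suc n)
davenport zero x A 1≤∣A∣ with element A 1≤∣A∣
... | i , i∈A = singleton i∈A (Z2^0-trivial _ _) ≤-refl
davenport (suc n) x A big with element A (≤-trans (s≤s z≤n) big)
... | i , i∈A with x i ≟ 0G
...   | yes xi≡0 = singleton i∈A xi≡0 (s≤s z≤n)
...   | no  xi≢0 = lift (davenport n (φ ∘ x) (A - i) (s≤s⁻¹ (subst (_ ≤_) (sym (∣-∣ A i i∈A)) big)))
  where
  open Collapse (collapse (x i) xi≢0)

  -- A zero-sum of the collapsed terms sums to 0 or to x i; in the latter case add the term x i.
  lift : ZeroSum (φ ∘ x) (A - i) (suc n) → ZeroSum x A (suc (suc n))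
  lift (zeroSum I I⊆A-i ne sh z) = by-kernel (kernel (subSum x I) (trans (sym (subSum-linear linear x I)) z))
    where
    I⊆A : I ⊆ A
    I⊆A = ⊆-trans I⊆A-i (p─q⊆p A ⁅ i ⁆)

    ∣I⊕i∣ : ∣ I ⊕ ⁅ i ⁆ ∣ ≡ suc ∣ I ∣
    ∣I⊕i∣ = ∣⊕⁅⁆∣ I i (∉-removed A i ∘ I⊆A-i)

    by-kernel : subSum x I ≡ 0G ⊎ subSum x I ≡ x i → ZeroSum x A (suc (suc n))
    by-kernel (inj₁ ΣI≡0)  = zeroSum I I⊆A ne (≤-trans sh (n≤1+n _)) ΣI≡0
    by-kernel (inj₂ ΣI≡xi) = zeroSum (I ⊕ ⁅ i ⁆) (⊕-⊆ I⊆A (⁅⁆⊆ i∈A))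
      (subst (1 ≤_) (sym ∣I⊕i∣) (s≤s z≤n)) (subst (_≤ _) (sym ∣I⊕i∣) (s≤s sh))
      (trans (subSum-⊕ x I ⁅ i ⁆) (trans (cong₂ _⊕_ ΣI≡xi (subSum-⁅⁆ x i)) (⊕-self (x i))))

subSum-lift : ∀ {n s} (x : Fin s → Z2^ n) (I : Subset s) →
              subSum (λ i → true ∷ x i) I ≡ parity ∣ I ∣ ∷ subSum x I
subSum-lift {s = zero}  x []          = refl
subSum-lift {s = suc s} x (true  ∷ I) = cong ((true ∷ x fzero) ⊕_) (subSum-lift (x ∘ fsuc) I)
subSum-lift {s = suc s} x (false ∷ I) = cong (0G ⊕_) (subSum-lift (x ∘ fsuc) I)

-- Any n + 2 terms contain a nonempty zero-sum subsequence of even size (at most n + 2):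
-- apply davenport to the lifted terms in Z_2^(n+1).
evenZeroSum : ∀ n {s} (x : Fin s → Z2^ n) (A : Subset s) → suc (suc n) ≤ ∣ A ∣ →
              Σ[ Z ∈ ZeroSum x A (suc (suc n)) ] parity ∣ ZeroSum.Z Z ∣ ≡ false
evenZeroSum n x A big with davenport (suc n) (λ i → true ∷ x i) A big
... | zeroSum Z Z⊆A ne sh z = zeroSum Z Z⊆A ne sh (∷-injectiveʳ lifted) , ∷-injectiveˡ lifted
  where
  lifted : parity ∣ Z ∣ ∷ subSum x Z ≡ false ∷ 0G
  lifted = trans (sym (subSum-lift x Z)) z

-- In a long enough non-constant sequence we find terms b, c of different values
-- and an even zero-sum subsequence Z through b avoiding c. Toggling Z then moves b in or
-- out of any subsequence without changing its sum or parity.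

record Pivot {n s} (x : Fin s → Z2^ n) (A : Subset s) : Set where
  constructor pivot
  field
    {b c}    : Fin s
    Z        : Subset s
    Z⊆A      : Z ⊆ A
    b∈Z      : b ∈ Z
    c∈A      : c ∈ A
    c∉Z      : c ∉ Z
    distinct : x b ≢ x c
    even     : parity ∣ Z ∣ ≡ false
    zero-sum : subSum x Z ≡ 0G

Constant : ∀ {n s} → (Fin s → Z2^ n) → Subset s → Set
Constant x A = ∃ λ c → ∀ {i} → i ∈ A → x i ≡ c

even-short : ∀ n k → parity k ≡ false → k ≤ suc (suc (suc n)) → k < suc (suc n + suc n)
even-short zero    k even k≤3 = ≤∧≢⇒< k≤3 λ { refl → odd3 even }
  where
  odd3 : parity 3 ≢ false
  odd3 ()
even-short (suc n) k _    k≤  = ≤-trans (s≤s k≤) (s≤s (s≤s (s≤s (m≤n+m (suc (suc n)) n))))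

module _ {n s} {x : Fin s → Z2^ n} {A : Subset s} {Z : Subset s}
         (Z⊆A : Z ⊆ A) (even : parity ∣ Z ∣ ≡ false) (zs : subSum x Z ≡ 0G) where

  pivot-or-constant′ : ∀ {z a} → z ∈ Z → a ∈ A → a ∉ Z → Pivot x A ⊎ Constant x A
  pivot-or-constant′ {z} {a} z∈Z a∈A a∉Z with any? (λ i → (i ∈? A) ×-dec ¬? (x i ≟ x z))
  ... | no  none              = inj₂ (x z , λ {i} i∈A → decidable-stable (x i ≟ x z) (λ xi≢xz → none (i , i∈A , xi≢xz)))
  ... | yes (i , i∈A , xi≢xz) = inj₁ (differing i∈A xi≢xz (i ∈? Z) (x a ≟ x z))
    where
    differing : ∀ {i} → i ∈ A → x i ≢ x z → Dec (i ∈ Z) → Dec (x a ≡ x z) → Pivot x A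
    differing i∈A xi≢xz (no  i∉Z) _           = pivot Z Z⊆A z∈Z i∈A i∉Z (≢-sym xi≢xz) even zs
    differing i∈A xi≢xz (yes i∈Z) (no  xa≢xz) = pivot Z Z⊆A z∈Z a∈A a∉Z (≢-sym xa≢xz) even zs
    differing i∈A xi≢xz (yes i∈Z) (yes xa≡xz) =
      pivot Z Z⊆A i∈Z a∈A a∉Z (λ xi≡xa → xi≢xz (trans xi≡xa xa≡xz)) even zs

-- A sequence of at least 2n + 1 terms in Z_2^n (n ≥ 1) is constant or has a pivot: an even
-- zero-sum subsequence exists, and it is short enough to leave a term outside.
pivot-or-constant : ∀ {n s} (x : Fin s → Z2^ (suc n)) (A : Subset s) →
                    suc (suc n + suc n) ≤ ∣ A ∣ → Pivot x A ⊎ Constant x A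
pivot-or-constant {n} x A big = from-even (evenZeroSum (suc n) x A (≤-trans (s≤s (s≤s (m≤n+m (suc n) n))) big))
  where
  from-even : Σ[ Z ∈ ZeroSum x A (suc (suc (suc n))) ] parity ∣ ZeroSum.Z Z ∣ ≡ false → Pivot x A ⊎ Constant x A
  from-even (zeroSum Z Z⊆A ne sh zs , even) =
    let z , z∈Z       = element Z ne
        a , a∈A , a∉Z = outside A Z (≤-trans (even-short n ∣ Z ∣ even sh) big)
    in pivot-or-constant′ Z⊆A even zs z∈Z a∈A a∉Z

record Separated {n s} (x : Fin s → Z2^ n) (A T : Subset s) : Set where
  constructor separated
  field
    {e e′}      : Fin s
    e∈A         : e ∈ A
    e′∈A        : e′ ∈ A
    distinct    : x e ≢ x e′
    T₁          : Subset s
    T₁⊆A        : T₁ ⊆ A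
    e∈T₁        : e ∈ T₁
    e′∉T₁       : e′ ∉ T₁
    same-sum    : subSum x T₁ ≡ subSum x T
    same-parity : parity ∣ T₁ ∣ ≡ parity ∣ T ∣

module _ {n s} {x : Fin s → Z2^ n} {A : Subset s} (P : Pivot x A) where
  open Pivot P

  toggle-sum : ∀ T → subSum x (T ⊕ Z) ≡ subSum x T
  toggle-sum T = trans (subSum-⊕ x T Z) (trans (cong (subSum x T ⊕_) zero-sum) (⊕-identityʳ _))

  toggle-parity : ∀ T → parity ∣ T ⊕ Z ∣ ≡ parity ∣ T ∣
  toggle-parity T = trans (parity-∣⊕∣ T Z) (trans (cong (parity ∣ T ∣ xor_) even) (xor-identityʳ _))

  separate : ∀ T → T ⊆ A → Separated x A T
  separate T T⊆A with c ∈? T | b ∈? T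
  ... | yes c∈T | yes b∈T = separated c∈A (Z⊆A b∈Z) (≢-sym distinct) (T ⊕ Z) (⊕-⊆ T⊆A Z⊆A)
                              (∈-⊕ˡ c∈T c∉Z) (∉-⊕-both b∈T b∈Z) (toggle-sum T) (toggle-parity T)
  ... | yes c∈T | no  b∉T = separated c∈A (Z⊆A b∈Z) (≢-sym distinct) T T⊆A c∈T b∉T refl refl
  ... | no  c∉T | yes b∈T = separated (Z⊆A b∈Z) c∈A distinct T T⊆A b∈T c∉T refl refl
  ... | no  c∉T | no  b∉T = separated (Z⊆A b∈Z) c∈A distinct (T ⊕ Z) (⊕-⊆ T⊆A Z⊆A)
                              (∈-⊕ʳ b∉T b∈Z) (∉-⊕ c∉T c∉Z) (toggle-sum T) (toggle-parity T)

SumOf : ∀ {n s} → (Fin s → Z2^ n) → Subset s → ℕ → Z2^ n → Set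
SumOf x A k v = ∃ λ T → T ⊆ A × ∣ T ∣ ≡ k × subSum x T ≡ v

FixedSize : ℕ → Set
FixedSize n = ∀ {s} (x : Fin s → Z2^ n) (A : Subset s) → suc (n + n) ≤ ∣ A ∣ →
              ∀ T → T ⊆ A → parity ∣ T ∣ ≡ parity n → SumOf x A n (subSum x T)

add-term : ∀ {n s} {x : Fin s → Z2^ n} {A T : Subset s} {f k v} →
           T ⊆ A → f ∈ A → f ∉ T → ∣ T ∣ ≡ k → subSum x T ≡ v ⊕ x f → SumOf x A (suc k) v
add-term {x = x} {T = T} {f} {v = v} T⊆A f∈A f∉T ∣T∣≡k ΣT =
  T ⊕ ⁅ f ⁆ , ⊕-⊆ T⊆A (⁅⁆⊆ f∈A) , trans (∣⊕⁅⁆∣ T f f∉T) (cong suc ∣T∣≡k) , (begin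
    subSum x (T ⊕ ⁅ f ⁆)          ≡⟨ subSum-⊕ x T ⁅ f ⁆ ⟩
    subSum x T ⊕ subSum x ⁅ f ⁆   ≡⟨ cong₂ _⊕_ ΣT (subSum-⁅⁆ x f) ⟩
    (v ⊕ x f) ⊕ x f               ≡⟨ ⊕-cancelʳ v (x f) ⟩
    v                             ∎)

-- Constant case: the sum only depends on the parity of the number of terms.
fixed-size-constant : ∀ {n s} (x : Fin s → Z2^ n) (A : Subset s) k → k ≤ ∣ A ∣ → Constant x A →
                      ∀ T → T ⊆ A → parity ∣ T ∣ ≡ parity k → SumOf x A k (subSum x T)
fixed-size-constant x A k k≤∣A∣ (c , const) T T⊆A par with choose A k k≤∣A∣
... | T′ , T′⊆A , ∣T′∣≡k = T′ , T′⊆A , ∣T′∣≡k , (begin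
  subSum x T′        ≡⟨ subSum-constant x T′ (const ∘ T′⊆A) ⟩
  parity ∣ T′ ∣ · c  ≡⟨ cong (λ j → parity j · c) ∣T′∣≡k ⟩
  parity k · c       ≡⟨ cong (_· c) par ⟨
  parity ∣ T ∣ · c   ≡⟨ subSum-constant x T (const ∘ T⊆A) ⟨
  subSum x T         ∎)

∣A-e-e′∣ : ∀ {s} {A : Subset s} {e e′} → e ∈ A → e′ ∈ A → e′ ≢ e → suc (suc ∣ A - e - e′ ∣) ≡ ∣ A ∣
∣A-e-e′∣ {A = A} {e} {e′} e∈A e′∈A e′≢e =
  trans (cong suc (∣-∣ (A - e) e′ (x∈p∧x≢y⇒x∈p-y e′∈A e′≢e))) (∣-∣ A e e∈A)

A-e-e′⊆A : ∀ {s} (A : Subset s) e e′ → A - e - e′ ⊆ A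
A-e-e′⊆A A e e′ = ⊆-trans (p─q⊆p (A - e) ⁅ e′ ⁆) (p─q⊆p A ⁅ e ⁆)

e∉A-e-e′ : ∀ {s} (A : Subset s) e e′ → e ∉ A - e - e′
e∉A-e-e′ A e e′ = ∉-removed A e ∘ p─q⊆p (A - e) ⁅ e′ ⁆

e′∉A-e-e′ : ∀ {s} (A : Subset s) e e′ → e′ ∉ A - e - e′
e′∉A-e-e′ A e e′ = ∉-removed (A - e) e′

-- Separated case: collapse w = x e ⊕ x e′, drop e and e′, and solve the problem in
-- dimension n for T₀ = T₁ - e, whose sum is v ⊕ x e. The solution found sums to v ⊕ x e
-- or v ⊕ x e′ (the two differ by w), so adding e or e′ to it gives n + 1 terms summing to v.
fixed-size-separated : ∀ {n} → FixedSize n → ∀ {s} (x : Fin s → Z2^ (suc n)) (A : Subset s) →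
                       suc (suc n + suc n) ≤ ∣ A ∣ → ∀ T → parity ∣ T ∣ ≡ parity (suc n) →
                       Separated x A T → SumOf x A (suc n) (subSum x T)
fixed-size-separated {n} ih x A big T par (separated {e} {e′} e∈A e′∈A distinct T₁ T₁⊆A e∈T₁ e′∉T₁ sum par₁) =
  lift (ih (φ ∘ x) (A - e - e′) big′ T₀ T₀⊆A′ parT₀)
  where
  open Collapse (collapse (x e ⊕ x e′) (distinct ∘ ⊕-unique))
  e′≢e : e′ ≢ e
  e′≢e e′≡e = distinct (sym (cong x e′≡e))

  big′ : suc (n + n) ≤ ∣ A - e - e′ ∣
  big′ = subst (_≤ ∣ A - e - e′ ∣) (+-suc n n) (s≤s⁻¹ (s≤s⁻¹ (subst (_ ≤_) (sym (∣A-e-e′∣ e∈A e′∈A e′≢e)) big)))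

  T₀ = T₁ ⊕ ⁅ e ⁆

  T₀⊆A′ : T₀ ⊆ A - e - e′
  T₀⊆A′ = ⊆-minus (⊆-minus (⊕-⊆ T₁⊆A (⁅⁆⊆ e∈A)) (∉-⊕-both e∈T₁ (x∈⁅x⁆ e))) (∉-⊕ e′∉T₁ (x≢y⇒x∉⁅y⁆ e′≢e))

  parT₀ : parity ∣ T₀ ∣ ≡ parity n
  parT₀ = begin
    parity ∣ T₁ ⊕ ⁅ e ⁆ ∣              ≡⟨ parity-∣⊕∣ T₁ ⁅ e ⁆ ⟩
    parity ∣ T₁ ∣ xor parity ∣ ⁅ e ⁆ ∣  ≡⟨ cong (λ j → parity ∣ T₁ ∣ xor parity j) (∣⁅x⁆∣≡1 e) ⟩
    parity ∣ T₁ ∣ xor true             ≡⟨ xor-comm (parity ∣ T₁ ∣) true ⟩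
    not (parity ∣ T₁ ∣)                ≡⟨ cong not (trans par₁ par) ⟩
    not (not (parity n))               ≡⟨ not-involutive (parity n) ⟩
    parity n                           ∎

  ΣT₀ : subSum x T₀ ≡ subSum x T ⊕ x e
  ΣT₀ = trans (subSum-⊕ x T₁ ⁅ e ⁆) (cong₂ _⊕_ sum (subSum-⁅⁆ x e))

  lift : SumOf (φ ∘ x) (A - e - e′) n (subSum (φ ∘ x) T₀) → SumOf x A (suc n) (subSum x T)
  lift (T″ , T″⊆A′ , ∣T″∣≡n , ΣφT″) = by-fibre (fibre (subSum x T″) (subSum x T₀) φΣT″)
    where
    φΣT″ : φ (subSum x T″) ≡ φ (subSum x T₀)
    φΣT″ = trans (sym (subSum-linear linear x T″)) (trans ΣφT″ (subSum-linear linear x T₀))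

    T″⊆A : T″ ⊆ A
    T″⊆A = ⊆-trans T″⊆A′ (A-e-e′⊆A A e e′)

    by-fibre : subSum x T″ ≡ subSum x T₀ ⊎ subSum x T″ ≡ (x e ⊕ x e′) ⊕ subSum x T₀ →
               SumOf x A (suc n) (subSum x T)
    by-fibre (inj₁ ΣT″≡ΣT₀)  = add-term T″⊆A e∈A (e∉A-e-e′ A e e′ ∘ T″⊆A′) ∣T″∣≡n (trans ΣT″≡ΣT₀ ΣT₀)
    by-fibre (inj₂ ΣT″≡wΣT₀) = add-term T″⊆A e′∈A (e′∉A-e-e′ A e e′ ∘ T″⊆A′) ∣T″∣≡n (begin
      subSum x T″                               ≡⟨ ΣT″≡wΣT₀ ⟩
      (x e ⊕ x e′) ⊕ subSum x T₀                ≡⟨ cong ((x e ⊕ x e′) ⊕_) ΣT₀ ⟩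
      (x e ⊕ x e′) ⊕ (subSum x T ⊕ x e)         ≡⟨ ⊕-exchange (x e) (x e′) (subSum x T) ⟩
      subSum x T ⊕ x e′                         ∎)

fixed-size : ∀ n → FixedSize n
fixed-size zero {s} x A _ T _ _ = ⊥ , ⊥⊆ , ∣⊥∣≡0 s , Z2^0-trivial _ _
fixed-size (suc n) x A big T T⊆A par = by-cases (pivot-or-constant x A big)
  where
  room : suc n ≤ ∣ A ∣
  room = ≤-trans (m≤m+n (suc n) (suc n)) (≤-trans (n≤1+n (suc n + suc n)) big)

  by-cases : Pivot x A ⊎ Constant x A → SumOf x A (suc n) (subSum x T)
  by-cases (inj₁ P)     = fixed-size-separated (fixed-size n) x A big T par (separate P T T⊆A)
  by-cases (inj₂ const) = fixed-size-constant x A (suc n) room const T T⊆A par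

-- Upper bound: for d < 2m, the whole sequence of 2m + d terms has size ≡ d (mod 2), so its
-- sum is a sum of exactly d terms; the complementary 2m terms then sum to 0.
upper-bound : ∀ m d → d < 2 * m → HasZeroSumSubseq (2 * m) d (2 * m + d)
upper-bound m d d<2m x = complement (fixed-size d x whole big whole ⊆-refl par)
  where
  whole : Subset (2 * m + d)
  whole = ⊤

  ∣whole∣ : ∣ whole ∣ ≡ 2 * m + d
  ∣whole∣ = ∣⊤∣≡n (2 * m + d)

  big : suc (d + d) ≤ ∣ whole ∣
  big = subst (suc (d + d) ≤_) (sym ∣whole∣) (+-monoˡ-≤ d d<2m)

  par : parity ∣ whole ∣ ≡ parity d
  par = begin
    parity ∣ whole ∣             ≡⟨ cong parity ∣whole∣ ⟩
    parity (2 * m + d)           ≡⟨ parity-+ (2 * m) d ⟩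
    parity (2 * m) xor parity d  ≡⟨ cong (λ j → parity (m + j) xor parity d) (+-identityʳ m) ⟩
    parity (m + m) xor parity d  ≡⟨ cong (_xor parity d) (parity-double m) ⟩
    parity d                     ∎

  complement : SumOf x whole d (subSum x whole) → ∃ λ I → ∣ I ∣ ≡ 2 * m × subSum x I ≡ 0G
  complement (T , _ , ∣T∣≡d , ΣT≡Σwhole) = ∁ T , ∣∁T∣ , Σ∁T
    where
    ∣∁T∣ : ∣ ∁ T ∣ ≡ 2 * m
    ∣∁T∣ = trans (∣∁p∣≡n∸∣p∣ T) (trans (cong (2 * m + d ∸_) ∣T∣≡d) (m+n∸n≡m (2 * m) d))

    Σ∁T : subSum x (∁ T) ≡ 0G
    Σ∁T = begin
      subSum x (∁ T)                  ≡⟨ cong (subSum x) (∁≡⊕⊤ T) ⟩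
      subSum x (T ⊕ whole)            ≡⟨ subSum-⊕ x T whole ⟩
      subSum x T ⊕ subSum x whole     ≡⟨ cong (_⊕ subSum x whole) ΣT≡Σwhole ⟩
      subSum x whole ⊕ subSum x whole ≡⟨ ⊕-self (subSum x whole) ⟩
      0G                              ∎

unitsThenZeros : ∀ d k → Fin (d + k) → Z2^ d
unitsThenZeros zero    k _        = []
unitsThenZeros (suc d) k fzero    = true ∷ 0G
unitsThenZeros (suc d) k (fsuc i) = false ∷ unitsThenZeros d k i

-- Only the k zero terms can occur in a zero sum, since the units are independent.
units-independent : ∀ d k (I : Subset (d + k)) → subSum (unitsThenZeros d k) I ≡ 0G → ∣ I ∣ ≤ k
units-independent zero    k I       _   = ∣p∣≤n I
units-independent (suc d) k (b ∷ I) Σ≡0 = by-head b (trans (cong (b · (true ∷ 0G) ⊕_) (sym tail-sum)) Σ≡0)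
  where
  tail-sum : subSum (λ i → false ∷ unitsThenZeros d k i) I ≡ false ∷ subSum (unitsThenZeros d k) I
  tail-sum = subSum-linear {f = false ∷_} (λ _ _ → refl) (unitsThenZeros d k) I

  by-head : ∀ b → b · (true ∷ 0G) ⊕ (false ∷ subSum (unitsThenZeros d k) I) ≡ 0G → ∣ b ∷ I ∣ ≤ k
  by-head true  Σ≡0 with ∷-injectiveˡ Σ≡0
  ... | ()
  by-head false Σ≡0 = units-independent d k I (trans (sym (⊕-identityˡ _)) (∷-injectiveʳ Σ≡0))

no-zero-sum : ∀ k d → ¬ HasZeroSumSubseq (suc k) d (d + k)
no-zero-sum k d H with H (unitsThenZeros d k)
... | I , ∣I∣≡1+k , ΣI≡0 = 1+n≰n (subst (_≤ k) ∣I∣≡1+k (units-independent d k I ΣI≡0))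

∣++⊥∣ : ∀ {s r} (I : Subset s) → ∣ I ++ ⊥ {r} ∣ ≡ ∣ I ∣
∣++⊥∣ {r = r} []          = ∣⊥∣≡0 r
∣++⊥∣         (true  ∷ I) = cong suc (∣++⊥∣ I)
∣++⊥∣         (false ∷ I) = ∣++⊥∣ I

subSum-++⊥ : ∀ {n s r} (y : Fin (s + r) → Z2^ n) (I : Subset s) →
             subSum y (I ++ ⊥) ≡ subSum (λ i → y (i ↑ˡ r)) I
subSum-++⊥ {s = zero}  y []      = subSum-⊥ y
subSum-++⊥ {s = suc s} y (b ∷ I) = cong (b · y fzero ⊕_) (subSum-++⊥ (y ∘ fsuc) I)

-- Having a zero-sum subsequence of length k is inherited by longer sequences: apply the
-- hypothesis to an initial segment.
extend : ∀ {k d s s′} → s ≤ s′ → HasZeroSumSubseq k d s → HasZeroSumSubseq k d s′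
extend s≤s′ H with m≤n⇒∃[o]m+o≡n s≤s′
... | r , refl = λ y → pad y (H (λ i → y (i ↑ˡ r)))
  where
  pad : ∀ {k d s} (y : Fin (s + r) → Z2^ d) → ∃ (λ I → ∣ I ∣ ≡ k × subSum (λ i → y (i ↑ˡ r)) I ≡ 0G) →
        ∃ λ I → ∣ I ∣ ≡ k × subSum y I ≡ 0G
  pad y (I , ∣I∣≡k , ΣI≡0) = I ++ ⊥ , trans (∣++⊥∣ I) ∣I∣≡k , trans (subSum-++⊥ y I) ΣI≡0

lower-bound : ∀ k d s → HasZeroSumSubseq (suc k) d s → suc k + d ≤ s
lower-bound k d s H with suc k + d ≤? s
... | yes long  = long
... | no  short = ⊥-elim (no-zero-sum k d (extend s≤d+k H))
  where
  s≤d+k : s ≤ d + k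
  s≤d+k = subst (s ≤_) (+-comm k d) (s≤s⁻¹ (≰⇒> short))

-- For 1 ≤ m and d < 2m both bounds hold, so s_2m(Z_2^d) = 2m + d
-- (note 2m = suc k for k = m - 1 + m).
theorem10 : (m d : ℕ) → 1 ≤ m → 1 ≤ d → d < 2 * m →
    IsS (2 * m) d (2 * m + d)
theorem10 zero    d _ _ ()
theorem10 (suc m) d _ _ d<2m = upper-bound (suc m) d d<2m , lower-bound (m + suc (m + 0)) d
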